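{- Let $t<k$ be positive integers and $v_1\le v_2\le\cdots\le v_k$ positive integers. If $A$ is a PDIMOA$^*(\prod_{i=k-t+1}^{k}v_i;t,k,(v_1,\dots,v_k))$, then $v_1<v_2<\cdots<v_k$ and $v_i\mid v_j$ for all $1\le i\le k-t$ and $k-t+1\le j\le k$.
   Context: A mixed orthogonal array MOA$(N;t,k,(v_1,\dots,v_k))$ is an $N\times k$ array whose $j$-th column has entries from a set $V_j$ with $|V_j|=v_j$, such that for every set $S$ of $t$ columns, each $t$-tuple in $\prod_{j\in S}V_j$ occurs as a row of the $N\times t$ subarray on $S$ the same number $\lambda_S$ of times ($\lambda_S=N/\prod_{j\in S}v_j$ is the index of $S$). It is a PDIMOA if the $\binom{k}{t}$ indices $\lambda_S$ are pairwise distinct; it is a PDIMOA$^*$ if moreover $\lambda_S=1$ for some $S$. -}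

module Defs where

open import Data.Nat using (ℕ; zero; suc; _*_; _<_; _≤_)
open import Data.Fin using (Fin; toℕ)
open import Data.Fin.Subset using (Subset; _∈_; ∣_∣)
open import Data.Fin.Subset.Properties using (_∈?_)
open import Data.Fin.Properties using (_≟_)
open import Data.List using (List; length; filter)
open import Data.Product using (Σ; ∃; _×_; _,_)
open import Relation.Nullary using (¬_; Dec; yes; no)
open import Relation.Unary using (Decidable)
open import Relation.Binary.PropositionalEquality using (_≡_)
open import Data.Vec using (_∷_; [])
import Data.Fin as Fin
open import Data.Fin.Subset using (inside; outside)
import Data.List
import Data.Vec
import Data.Nat
open import Relation.Nullary.Decidable using (Dec; yes; no)

Row : (k : ℕ) → (Fin k → ℕ) → Set
Row k v = (j : Fin k) → Fin (v j)

Array : (k : ℕ) → (Fin k → ℕ) → Set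
Array k v = List (Row k v)

Tuple : {k : ℕ} → (Fin k → ℕ) → Subset k → Set
Tuple {k} v S = (j : Fin k) → j ∈ S → Fin (v j)

Matches : {k : ℕ} {v : Fin k → ℕ} (S : Subset k) → Tuple v S → Row k v → Set
Matches S u r = ∀ j → (p : j ∈ S) → r j ≡ u j p

matches? : {k : ℕ} {v : Fin k → ℕ} (S : Subset k) (u : Tuple v S) → Decidable (Matches S u)
matches? {zero} [] u r = yes (λ ())
matches? {suc k} {v} (b ∷ S) u r
  with matches? {k} {λ j → v (Fin.suc j)} S (λ j p → u (Fin.suc j) (Data.Vec.there p)) (λ j → r (Fin.suc j))
... | no ¬m = no (λ m → ¬m (λ j p → m (Fin.suc j) (Data.Vec.there p)))
matches? {suc k} {v} (outside ∷ S) u r | yes m =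
  yes λ { Fin.zero () ; (Fin.suc j) (Data.Vec.there p) → m j p }
matches? {suc k} {v} (inside ∷ S) u r | yes m with r Fin.zero ≟ u Fin.zero Data.Vec.here
... | yes e = yes λ { Fin.zero Data.Vec.here → e ; (Fin.suc j) (Data.Vec.there p) → m j p }
... | no ne = no (λ m' → ne (m' Fin.zero Data.Vec.here))

count : {k : ℕ} {v : Fin k → ℕ} → Array k v → (S : Subset k) → Tuple v S → ℕ
count A S u = length (filter (matches? S u) A)

HasIndex : {k : ℕ} {v : Fin k → ℕ} → Array k v → Subset k → ℕ → Set
HasIndex {k} {v} A S λ' = (u : Tuple v S) → count A S u ≡ λ'

IsMOA : (N t k : ℕ) (v : Fin k → ℕ) → Array k v → Set
IsMOA N t k v A = length A ≡ N × ((S : Subset k) → ∣ S ∣ ≡ t → ∃ λ λ' → HasIndex A S λ')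

IsPDIMOA : (N t k : ℕ) (v : Fin k → ℕ) → Array k v → Set
IsPDIMOA N t k v A = IsMOA N t k v A ×
  ((S S' : Subset k) → ∣ S ∣ ≡ t → ∣ S' ∣ ≡ t → ¬ S ≡ S' →
     (λ₁ λ₂ : ℕ) → HasIndex A S λ₁ → HasIndex A S' λ₂ → ¬ λ₁ ≡ λ₂)

IsPDIMOA* : (N t k : ℕ) (v : Fin k → ℕ) → Array k v → Set
IsPDIMOA* N t k v A = IsPDIMOA N t k v A × ∃ λ S → ∣ S ∣ ≡ t × HasIndex A S 1

-- product of v i over i ∈ {from, …, k-1} (0-based), i.e. ∏_{i=from+1}^{k} v_i in 1-based terms
prodFrom : {k : ℕ} → (Fin k → ℕ) → ℕ → ℕ
prodFrom {k} v from = Data.List.foldr _*_ 1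
  (Data.List.map v (filter (λ i → from Data.Nat.≤? toℕ i) (Data.List.allFin k)))

-- Counting the rows of A according to their restriction to a t-set S gives
-- N = λ_S · ∏_{j∈S} v_j for every t-set S.  Exchanging one column of a t-set
-- therefore rescales its index by a ratio of two alphabet sizes.  If i ≠ j and
-- T is a (t-1)-set avoiding both, then λ_{T∪{i}} v_i = λ_{T∪{j}} v_j, so
-- v_i = v_j would give two distinct t-sets the same index; with the monotonicity
-- of v this forces v_1 < ⋯ < v_k.  If L is the set of the last t columns then
-- N = ∏_{j∈L} v_j, and replacing j ∈ L by i ∉ L gives v_j = λ_{L-j+i} v_i.
module Submission where

open import Defs
open import Data.Bool using (true; false)
open import Data.Empty using (⊥-elim)
open import Data.Fin using (Fin; zero; suc; toℕ)
open import Data.Fin.Properties using (_≟_)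
open import Data.Fin.Subset using (Subset; inside; outside; _∈_; _∉_; _⊆_; ⊥; ⊤; ∣_∣)
open import Data.Fin.Subset.Properties using (∉⊥; ∣⊥∣≡0; out⊆; s⊆s; ∈⊤; ∣⊤∣≡n)
open import Data.List as List using (List; []; _∷_; [_]; length; filter; map; foldr)
open import Data.List.Properties using (length-map; length-++; filter-++; filter-≐; filter-all)
open import Data.List.Relation.Unary.All using (universal)
open import Data.Nat using (ℕ; zero; suc; _+_; _*_; _<_; _≤_; _∸_; s≤s; s≤s⁻¹; _≤?_; NonZero; >-nonZero)
open import Data.Nat.Divisibility using (_∣_; divides)
open import Data.Nat.Properties
  using (*-identityʳ; *-assoc; *-cancelʳ-≡; m*n≢0; *-commutativeSemigroup; +-0-commutativeMonoid;
         +-cancelˡ-≤; 0∸n≡0; m∸[m∸n]≡n; <⇒≤; <⇒≢; <⇒≱; ≤∧≢⇒<)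
open import Algebra.Properties.CommutativeMonoid.Sum +-0-commutativeMonoid
  using (sum-syntax; sum-cong-≗; sum-replicate-zero; ∑-distrib-+)
open import Algebra.Properties.CommutativeSemigroup *-commutativeSemigroup using (x∙yz≈y∙xz)
open import Data.Product using (Σ; _×_; _,_; proj₁; proj₂)
open import Data.Vec as Vec using ([]; _∷_; here; there; _[_]≔_)
open import Data.Vec.Properties
  using (tabulate-cong; lookup∘tabulate; lookup⇒[]=; []=⇒lookup; []≔-idempotent; []≔-lookup; []≔-updates; []≔-minimal)
open import Relation.Binary.PropositionalEquality
  using (_≡_; _≢_; refl; sym; trans; cong; cong₂; subst; module ≡-Reasoning)
open import Relation.Nullary using (Dec; does; ¬_)
open import Relation.Nullary.Decidable using (_×-dec_; map′; does-≡; dec-true; dec-false)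
open import Relation.Unary using (Pred; Decidable; _≐_)

module _ {a b p} {A : Set a} {B : Set b} {P : Pred B p} (P? : Decidable P) (f : A → B) where

  length-filter-map : ∀ xs → length (filter P? (map f xs)) ≡ length (filter (λ x → P? (f x)) xs)
  length-filter-map [] = refl
  length-filter-map (x ∷ xs) with does (P? (f x))
  ... | true = cong suc (length-filter-map xs)
  ... | false = length-filter-map xs

module _ {a p q} {A : Set a} {P : Pred A p} {Q : Pred A q} (P? : Decidable P) (Q? : Decidable Q) where

  filter-filter : ∀ xs → filter Q? (filter P? xs) ≡ filter (λ x → P? x ×-dec Q? x) xs
  filter-filter [] = refl
  filter-filter (x ∷ xs) with does (P? x)
  ... | false = filter-filter xs
  ... | true with does (Q? x)
  ...   | true = cong (x ∷_) (filter-filter xs)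
  ...   | false = filter-filter xs

∑-const : ∀ n c → ∑[ i < n ] c ≡ n * c
∑-const zero c = refl
∑-const (suc n) c = cong (c +_) (∑-const n c)

∑-length-filter-≟-singleton : ∀ {n} (a : Fin n) → ∑[ b < n ] length (filter (_≟ b) [ a ]) ≡ 1
∑-length-filter-≟-singleton {suc n} zero = cong suc (sum-replicate-zero n)
∑-length-filter-≟-singleton {suc n} (suc a) =
  trans (sum-cong-≗ length-filter-suc) (∑-length-filter-≟-singleton a)
  where
  length-filter-suc : ∀ b → length (filter (_≟ suc b) [ suc a ]) ≡ length (filter (_≟ b) [ a ])
  length-filter-suc b with does (a ≟ b)
  ... | true = refl
  ... | false = refl

∑-length-filter-≟ : ∀ {n} (as : List (Fin n)) → ∑[ b < n ] length (filter (_≟ b) as) ≡ length as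
∑-length-filter-≟ {n} [] = sum-replicate-zero n
∑-length-filter-≟ {n} (a ∷ as) = begin
  ∑[ b < n ] length (filter (_≟ b) (a ∷ as))
    ≡⟨ sum-cong-≗ (λ b → trans (cong length (filter-++ (_≟ b) [ a ] as)) (length-++ (filter (_≟ b) [ a ]))) ⟩
  ∑[ b < n ] (length (filter (_≟ b) [ a ]) + length (filter (_≟ b) as))
    ≡⟨ ∑-distrib-+ (λ b → length (filter (_≟ b) [ a ])) (λ b → length (filter (_≟ b) as)) ⟩
  ∑[ b < n ] length (filter (_≟ b) [ a ]) + ∑[ b < n ] length (filter (_≟ b) as)
    ≡⟨ cong₂ _+_ (∑-length-filter-≟-singleton a) (∑-length-filter-≟ as) ⟩
  suc (length as) ∎
  where open ≡-Reasoning

length≡∑-length-filter-≟ : ∀ {a} {A : Set a} {n} (g : A → Fin n) xs →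
  length xs ≡ ∑[ b < n ] length (filter (λ x → g x ≟ b) xs)
length≡∑-length-filter-≟ {n = n} g xs = begin
  length xs                                     ≡⟨ length-map g xs ⟨
  length (map g xs)                             ≡⟨ ∑-length-filter-≟ (map g xs) ⟨
  ∑[ b < n ] length (filter (_≟ b) (map g xs))  ≡⟨ sum-cong-≗ (λ b → length-filter-map (_≟ b) g xs) ⟩
  ∑[ b < n ] length (filter (λ x → g x ≟ b) xs) ∎
  where open ≡-Reasoning

∏ : ∀ {k} → (Fin k → ℕ) → Subset k → ℕ
∏ {zero} v [] = 1
∏ {suc k} v (inside ∷ S) = v zero * ∏ (λ j → v (suc j)) S
∏ {suc k} v (outside ∷ S) = ∏ (λ j → v (suc j)) S

∏-nonZero : ∀ {k} (v : Fin k → ℕ) → (∀ i → NonZero (v i)) → ∀ S → NonZero (∏ v S)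
∏-nonZero v v≢0 [] = _
∏-nonZero v v≢0 (inside ∷ S) =
  m*n≢0 (v zero) _ {{v≢0 zero}} {{∏-nonZero (λ j → v (suc j)) (λ j → v≢0 (suc j)) S}}
∏-nonZero v v≢0 (outside ∷ S) = ∏-nonZero (λ j → v (suc j)) (λ j → v≢0 (suc j)) S

foldr-*-map-filter-tabulate : ∀ {a p k} {B : Set a} {P : Pred B p} (w : B → ℕ) (P? : Decidable P) (h : Fin k → B) →
  foldr _*_ 1 (map w (filter P? (List.tabulate h))) ≡ ∏ (λ i → w (h i)) (Vec.tabulate (λ i → does (P? (h i))))
foldr-*-map-filter-tabulate {k = zero} w P? h = refl
foldr-*-map-filter-tabulate {k = suc k} w P? h with does (P? (h zero))
... | true = cong (w (h zero) *_) (foldr-*-map-filter-tabulate w P? (λ i → h (suc i)))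
... | false = foldr-*-map-filter-tabulate w P? (λ i → h (suc i))

rowTail : ∀ {k} {v : Fin (suc k) → ℕ} → Row (suc k) v → Row k (λ j → v (suc j))
rowTail r j = r (suc j)

module _ {k} {v : Fin (suc k) → ℕ} {S : Subset k} where

  consOutside : Tuple (λ j → v (suc j)) S → Tuple v (outside ∷ S)
  consOutside u (suc j) (there p) = u j p

  consInside : Fin (v zero) → Tuple (λ j → v (suc j)) S → Tuple v (inside ∷ S)
  consInside a u zero here = a
  consInside a u (suc j) (there p) = u j p

  Matches-consOutside : ∀ u → Matches (outside ∷ S) (consOutside u) ≐ (λ r → Matches S u (rowTail r))
  Matches-consOutside u = (λ m j p → m (suc j) (there p))
                        , λ { m (suc j) (there p) → m j p }

  Matches-consInside : ∀ a u →
    Matches (inside ∷ S) (consInside a u) ≐ (λ r → r zero ≡ a × Matches S u (rowTail r))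
  Matches-consInside a u = (λ m → m zero here , λ j p → m (suc j) (there p))
                         , λ { (e , m) zero here → e ; (e , m) (suc j) (there p) → m j p }

  HasIndex-rowTail : ∀ {A : Array (suc k) v} {λ'} → HasIndex A (outside ∷ S) λ' → HasIndex (map rowTail A) S λ'
  HasIndex-rowTail {A} {λ'} h u = begin
    length (filter (matches? S u) (map rowTail A))     ≡⟨ length-filter-map (matches? S u) rowTail A ⟩
    length (filter (λ r → matches? S u (rowTail r)) A) ≡⟨ cong length (filter-≐ _ _ (Matches-consOutside u) A) ⟨
    count A (outside ∷ S) (consOutside u)               ≡⟨ h (consOutside u) ⟩
    λ' ∎
    where open ≡-Reasoning

  HasIndex-rowTail-filter : ∀ {A : Array (suc k) v} {λ'} → HasIndex A (inside ∷ S) λ' →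
    ∀ a → HasIndex (map rowTail (filter (λ r → r zero ≟ a) A)) S λ'
  HasIndex-rowTail-filter {A} {λ'} h a u = begin
    length (filter (matches? S u) (map rowTail (filter (λ r → r zero ≟ a) A)))
      ≡⟨ length-filter-map (matches? S u) rowTail (filter (λ r → r zero ≟ a) A) ⟩
    length (filter (λ r → matches? S u (rowTail r)) (filter (λ r → r zero ≟ a) A))
      ≡⟨ cong length (filter-filter (λ r → r zero ≟ a) (λ r → matches? S u (rowTail r)) A) ⟩
    length (filter (λ r → (r zero ≟ a) ×-dec matches? S u (rowTail r)) A)
      ≡⟨ cong length (filter-≐ _ _ (Matches-consInside a u) A) ⟨
    count A (inside ∷ S) (consInside a u)
      ≡⟨ h (consInside a u) ⟩
    λ' ∎
    where open ≡-Reasoning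

length≡index*∏ : ∀ {k} {v : Fin k → ℕ} (A : Array k v) (S : Subset k) {λ'} →
  HasIndex A S λ' → length A ≡ λ' * ∏ v S
length≡index*∏ A [] {λ'} h = begin
  length A     ≡⟨ cong length (filter-all (matches? [] u) (universal (λ r j ()) A)) ⟨
  count A [] u ≡⟨ h u ⟩
  λ'           ≡⟨ *-identityʳ λ' ⟨
  λ' * 1       ∎
  where
  open ≡-Reasoning
  u : Tuple _ []
  u ()
length≡index*∏ A (outside ∷ S) {λ'} h = begin
  length A               ≡⟨ length-map rowTail A ⟨
  length (map rowTail A) ≡⟨ length≡index*∏ (map rowTail A) S (HasIndex-rowTail {A = A} h) ⟩
  λ' * ∏ _ S ∎
  where open ≡-Reasoning
length≡index*∏ {v = v} A (inside ∷ S) {λ'} h = begin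
  length A                                             ≡⟨ length≡∑-length-filter-≟ (λ r → r zero) A ⟩
  ∑[ a < v zero ] length (filter (λ r → r zero ≟ a) A) ≡⟨ sum-cong-≗ length-part ⟩
  ∑[ a < v zero ] (λ' * ∏ v′ S)                        ≡⟨ ∑-const (v zero) _ ⟩
  v zero * (λ' * ∏ v′ S)                               ≡⟨ x∙yz≈y∙xz (v zero) λ' _ ⟩
  λ' * (v zero * ∏ v′ S)                               ∎
  where
  open ≡-Reasoning
  v′ = λ j → v (suc j)
  length-part : ∀ a → length (filter (λ r → r zero ≟ a) A) ≡ λ' * ∏ v′ S
  length-part a = trans (sym (length-map rowTail part))
                        (length≡index*∏ (map rowTail part) S (HasIndex-rowTail-filter {A = A} h a))
    where part = filter (λ r → r zero ≟ a) A

∉-[]≔ : ∀ {k} {x y : Fin k} {S b} → y ≢ x → y ∉ S → y ∉ S [ x ]≔ b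
∉-[]≔ {x = zero} {zero} y≢x _ = ⊥-elim (y≢x refl)
∉-[]≔ {x = zero} {suc y} {_ ∷ S} _ y∉S (there y∈S′) = y∉S (there y∈S′)
∉-[]≔ {x = suc x} {zero} {_ ∷ S} _ y∉S here = y∉S here
∉-[]≔ {x = suc x} {suc y} {_ ∷ S} y≢x y∉S (there y∈S′) =
  ∉-[]≔ (λ y≡x → y≢x (cong suc y≡x)) (λ y∈S → y∉S (there y∈S)) y∈S′

x∉S[x]≔outside : ∀ {k} (S : Subset k) x → x ∉ S [ x ]≔ outside
x∉S[x]≔outside (_ ∷ S) (suc x) (there x∈S′) = x∉S[x]≔outside S x x∈S′

[]≔outside-[]≔inside : ∀ {k} {S : Subset k} {x} → x ∈ S → (S [ x ]≔ outside) [ x ]≔ inside ≡ S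
[]≔outside-[]≔inside {S = S} {x} x∈S = trans ([]≔-idempotent S x)
  (subst (λ b → S [ x ]≔ b ≡ S) ([]=⇒lookup x∈S) ([]≔-lookup S x))

∣S[x]≔inside∣ : ∀ {k} {S : Subset k} {x} → x ∉ S → ∣ S [ x ]≔ inside ∣ ≡ suc ∣ S ∣
∣S[x]≔inside∣ {S = outside ∷ S} {zero} _ = refl
∣S[x]≔inside∣ {S = inside ∷ S} {zero} x∉S = ⊥-elim (x∉S here)
∣S[x]≔inside∣ {S = outside ∷ S} {suc x} x∉S = ∣S[x]≔inside∣ (λ x∈S → x∉S (there x∈S))
∣S[x]≔inside∣ {S = inside ∷ S} {suc x} x∉S = cong suc (∣S[x]≔inside∣ (λ x∈S → x∉S (there x∈S)))

∣S[x]≔outside∣ : ∀ {k} {S : Subset k} {x} → x ∈ S → suc ∣ S [ x ]≔ outside ∣ ≡ ∣ S ∣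
∣S[x]≔outside∣ {S = S} {x} x∈S =
  trans (sym (∣S[x]≔inside∣ (x∉S[x]≔outside S x))) (cong ∣_∣ ([]≔outside-[]≔inside x∈S))

∏-[]≔inside : ∀ {k} (v : Fin k → ℕ) {S : Subset k} {x} → x ∉ S → ∏ v (S [ x ]≔ inside) ≡ v x * ∏ v S
∏-[]≔inside v {outside ∷ S} {zero} _ = refl
∏-[]≔inside v {inside ∷ S} {zero} x∉S = ⊥-elim (x∉S here)
∏-[]≔inside v {outside ∷ S} {suc x} x∉S = ∏-[]≔inside (λ j → v (suc j)) (λ x∈S → x∉S (there x∈S))
∏-[]≔inside v {inside ∷ S} {suc x} x∉S = trans
  (cong (v zero *_) (∏-[]≔inside (λ j → v (suc j)) (λ x∈S → x∉S (there x∈S))))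
  (x∙yz≈y∙xz (v zero) (v (suc x)) _)

∏-[]≔outside : ∀ {k} (v : Fin k → ℕ) {S : Subset k} {x} → x ∈ S → v x * ∏ v (S [ x ]≔ outside) ≡ ∏ v S
∏-[]≔outside v {S} {x} x∈S =
  trans (sym (∏-[]≔inside v (x∉S[x]≔outside S x))) (cong (∏ v) ([]≔outside-[]≔inside x∈S))

subset-of-size : ∀ {k m} (Y : Subset k) → m ≤ ∣ Y ∣ → Σ (Subset k) λ T → T ⊆ Y × ∣ T ∣ ≡ m
subset-of-size {k} {zero} Y _ = ⊥ , (λ x∈⊥ → ⊥-elim (∉⊥ x∈⊥)) , ∣⊥∣≡0 k
subset-of-size {m = suc m} (inside ∷ Y) (s≤s m≤∣Y∣) with subset-of-size Y m≤∣Y∣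
... | T , T⊆Y , ∣T∣≡m = inside ∷ T , s⊆s T⊆Y , cong suc ∣T∣≡m
subset-of-size {m = suc m} (outside ∷ Y) m≤∣Y∣ with subset-of-size Y m≤∣Y∣
... | T , T⊆Y , ∣T∣≡m = outside ∷ T , out⊆ T⊆Y , ∣T∣≡m

subset-avoiding-two : ∀ {k m} {i j : Fin k} → 2 + m ≤ k → i ≢ j →
  Σ (Subset k) λ T → i ∉ T × j ∉ T × ∣ T ∣ ≡ m
subset-avoiding-two {k} {m} {i} {j} m+2≤k i≢j with subset-of-size Y m≤∣Y∣
  where
  Y = (⊤ [ i ]≔ outside) [ j ]≔ outside
  ∣Y∣ : 2 + ∣ Y ∣ ≡ k
  ∣Y∣ = begin
    2 + ∣ Y ∣                ≡⟨ cong suc (∣S[x]≔outside∣ ([]≔-minimal ⊤ j i (λ j≡i → i≢j (sym j≡i)) ∈⊤)) ⟩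
    suc ∣ ⊤ [ i ]≔ outside ∣ ≡⟨ ∣S[x]≔outside∣ {S = ⊤ {k}} {i} ∈⊤ ⟩
    ∣ ⊤ {k} ∣                ≡⟨ ∣⊤∣≡n k ⟩
    k                        ∎
    where open ≡-Reasoning
  m≤∣Y∣ : m ≤ ∣ Y ∣
  m≤∣Y∣ = +-cancelˡ-≤ 2 m ∣ Y ∣ (subst (2 + m ≤_) (sym ∣Y∣) m+2≤k)
... | T , T⊆Y , ∣T∣ = T , (λ i∈T → ∉-[]≔ i≢j (x∉S[x]≔outside ⊤ i) (T⊆Y i∈T))
                        , (λ j∈T → x∉S[x]≔outside (⊤ [ i ]≔ outside) j (T⊆Y j∈T)) , ∣T∣

module _ {p k} {P : Pred (Fin k) p} (P? : Decidable P) where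

  ∈-tabulate-does : ∀ {i} → P i → i ∈ Vec.tabulate (λ j → does (P? j))
  ∈-tabulate-does {i} Pi = lookup⇒[]= i _ (trans (lookup∘tabulate _ i) (dec-true (P? i) Pi))

  ∉-tabulate-does : ∀ {i} → ¬ P i → i ∉ Vec.tabulate (λ j → does (P? j))
  ∉-tabulate-does {i} ¬Pi i∈ with () ←
    trans (sym (dec-false (P? i) ¬Pi)) (trans (sym (lookup∘tabulate _ i)) ([]=⇒lookup i∈))

∣tabulate-≤?∣ : ∀ k m → ∣ Vec.tabulate {n = k} (λ i → does (m ≤? toℕ i)) ∣ ≡ k ∸ m
∣tabulate-≤?∣ zero m = sym (0∸n≡0 m)
∣tabulate-≤?∣ (suc k) zero = cong suc (∣tabulate-≤?∣ k zero)
∣tabulate-≤?∣ (suc k) (suc m) = trans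
  (cong (∣_∣ {n = k}) (tabulate-cong (λ i → does-≡ (suc m ≤? suc (toℕ i)) (map′ s≤s s≤s⁻¹ (m ≤? toℕ i)))))
  (∣tabulate-≤?∣ k m)

length≡index*v*∏ : ∀ {k} {v : Fin k → ℕ} (A : Array k v) {T x λ'} → x ∉ T →
  HasIndex A (T [ x ]≔ inside) λ' → length A ≡ λ' * (v x * ∏ v T)
length≡index*v*∏ {v = v} A {T} {x} {λ'} x∉T h =
  trans (length≡index*∏ A (T [ x ]≔ inside) h) (cong (λ' *_) (∏-[]≔inside v x∉T))

module _ {N t k : ℕ} {v : Fin k → ℕ} (v≢0 : ∀ i → NonZero (v i)) (A : Array k v) where

  PDIMOA⇒v-injective : IsPDIMOA N (suc t) k v A → suc t < k → ∀ {i j} → i ≢ j → v i ≢ v j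
  PDIMOA⇒v-injective ((_ , index) , distinct) t<k {i} {j} i≢j vi≡vj
    with subset-avoiding-two t<k i≢j
  ... | T , i∉T , j∉T , ∣T∣ = distinct S₁ S₂ ∣S₁∣ ∣S₂∣ S₁≢S₂ λ₁ λ₂ h₁ h₂ λ₁≡λ₂
    where
    S₁ = T [ i ]≔ inside
    S₂ = T [ j ]≔ inside
    ∣S₁∣ = trans (∣S[x]≔inside∣ i∉T) (cong suc ∣T∣)
    ∣S₂∣ = trans (∣S[x]≔inside∣ j∉T) (cong suc ∣T∣)
    S₁≢S₂ : S₁ ≢ S₂
    S₁≢S₂ S₁≡S₂ = ∉-[]≔ i≢j i∉T (subst (i ∈_) S₁≡S₂ ([]≔-updates T i))
    λ₁ = proj₁ (index S₁ ∣S₁∣)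
    h₁ = proj₂ (index S₁ ∣S₁∣)
    λ₂ = proj₁ (index S₂ ∣S₂∣)
    h₂ = proj₂ (index S₂ ∣S₂∣)
    λ₁≡λ₂ : λ₁ ≡ λ₂
    λ₁≡λ₂ = *-cancelʳ-≡ λ₁ λ₂ (v j * ∏ v T) {{m*n≢0 (v j) _ {{v≢0 j}} {{∏-nonZero v v≢0 T}}}} (begin
      λ₁ * (v j * ∏ v T) ≡⟨ cong (λ w → λ₁ * (w * ∏ v T)) vi≡vj ⟨
      λ₁ * (v i * ∏ v T) ≡⟨ length≡index*v*∏ A i∉T h₁ ⟨
      length A           ≡⟨ length≡index*v*∏ A j∉T h₂ ⟩
      λ₂ * (v j * ∏ v T) ∎)
      where open ≡-Reasoning

  index-one⇒divides : IsMOA N t k v A → ∀ {L} → ∣ L ∣ ≡ t → length A ≡ ∏ v L →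
    ∀ {i j} → i ∉ L → j ∈ L → v i ∣ v j
  index-one⇒divides (_ , index) {L} ∣L∣ lengthA {i} {j} i∉L j∈L =
    divides λ' (*-cancelʳ-≡ (v j) (λ' * v i) (∏ v T) {{∏-nonZero v v≢0 T}} (begin
      v j * ∏ v T        ≡⟨ ∏-[]≔outside v j∈L ⟩
      ∏ v L              ≡⟨ lengthA ⟨
      length A           ≡⟨ length≡index*v*∏ A i∉T h ⟩
      λ' * (v i * ∏ v T) ≡⟨ *-assoc λ' (v i) (∏ v T) ⟨
      λ' * v i * ∏ v T   ∎))
    where
    open ≡-Reasoning
    T = L [ j ]≔ outside
    i∉T : i ∉ T
    i∉T = ∉-[]≔ (λ { refl → i∉L j∈L }) i∉L
    ∣S∣ : ∣ T [ i ]≔ inside ∣ ≡ t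
    ∣S∣ = trans (∣S[x]≔inside∣ i∉T) (trans (∣S[x]≔outside∣ j∈L) ∣L∣)
    λ' = proj₁ (index (T [ i ]≔ inside) ∣S∣)
    h = proj₂ (index (T [ i ]≔ inside) ∣S∣)

lemma4p3 : (t k : ℕ) → 0 < t → t < k → (v : Fin k → ℕ) →
    (∀ i → 0 < v i) → (∀ i j → toℕ i ≤ toℕ j → v i ≤ v j) →
    (A : Array k v) → IsPDIMOA* (prodFrom v (k ∸ t)) t k v A →
    (∀ i j → toℕ i < toℕ j → v i < v j)
    × (∀ i j → toℕ i < k ∸ t → k ∸ t ≤ toℕ j → v i ∣ v j)
lemma4p3 (suc t) k _ t<k v v>0 v-mono A (isPDIMOA@(isMOA@(lengthA , _) , _) , _) =
    (λ i j i<j → ≤∧≢⇒< (v-mono i j (<⇒≤ i<j))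
                   (PDIMOA⇒v-injective v≢0 A isPDIMOA t<k (λ i≡j → <⇒≢ i<j (cong toℕ i≡j))))
  , λ i j i<k-t k-t≤j → index-one⇒divides v≢0 A isMOA ∣L∣ lengthA≡∏L
                         (∉-tabulate-does inL? (<⇒≱ i<k-t)) (∈-tabulate-does inL? k-t≤j)
  where
  v≢0 : ∀ i → NonZero (v i)
  v≢0 i = >-nonZero (v>0 i)
  inL? : (i : Fin k) → Dec (k ∸ suc t ≤ toℕ i)
  inL? i = k ∸ suc t ≤? toℕ i
  L : Subset k
  L = Vec.tabulate (λ i → does (inL? i))
  ∣L∣ : ∣ L ∣ ≡ suc t
  ∣L∣ = trans (∣tabulate-≤?∣ k (k ∸ suc t)) (m∸[m∸n]≡n (<⇒≤ t<k))
  lengthA≡∏L : length A ≡ ∏ v L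
  lengthA≡∏L = trans lengthA (foldr-*-map-filter-tabulate v inL? (λ i → i))
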